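{- (i) $\mathcal{C}\setminus\mathcal{C}'$ is not a subset of $\mathcal{L}\setminus\mathcal{S}$. (ii) $\mathcal{C}_3\setminus\mathcal{C}'_3$ is a proper subset of $\mathcal{L}\setminus\mathcal{S}$.
   Context: For an integer base $g\ge2$ and integer $m\ge0$, $s_g(m)$ denotes the sum of base-$g$ digits of $m$; $s_1(m):=0$. $\mathcal{L}$ is the set of positive integers $m$ having a divisor $g$ with $s_g(m)=g$. A positive integer $m$ has a strict $s$-decomposition if $m=\prod_{\nu=1}^n g_\nu^{e_\nu}$ with exponents $e_\nu\ge1$ and proper factors $1<g_\nu<m$, strictly increasing $g_1<\dots<g_n$ (not necessarily coprime), with $s_{g_\nu}(m)=g_\nu$ for each $\nu$; $\mathcal{S}$ is the set of such $m$. $\mathcal{C}$ is the set of Carmichael numbers (composite positive $m$ with $a^{m-1}\equiv1\pmod m$ for all $a$ coprime to $m$), $\mathcal{C}_3$ those with exactly three prime factors. $\mathcal{C}'$ is the set of squarefree integers $m>1$ with $s_p(m)=p$ for every prime $p\mid m$, and $\mathcal{C}'_3$ those with exactly three prime factors. -}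

module Defs where

open import Data.Nat using (ℕ; zero; suc; _+_; _*_; _∸_; _^_; _<_; _≤_)
open import Data.Nat.DivMod using (_%_; _/_)
open import Data.Nat.Divisibility using (_∣_; _∣?_)
open import Data.Nat.Primality using (Prime; Composite; prime?)
open import Data.Nat.Coprimality using (Coprime)
open import Data.Nat.Properties using (_≟_)
open import Data.List using (List; []; _∷_; map; length; filter; upTo)
open import Data.Nat.ListAction using (product)
open import Data.List.Relation.Unary.All using (All)
open import Data.List.Relation.Unary.Linked using (Linked)
open import Data.Product using (_×_; _,_; proj₁; ∃-syntax)
open import Relation.Nullary using (¬_)
open import Relation.Nullary.Decidable using (_×-dec_)
open import Relation.Binary.PropositionalEquality using (_≡_)

-- s_g(m): sum of base-g digits of m (g ≥ 2); s_0(m) = s_1(m) := 0.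
-- Fuel m suffices since m / g < m for m > 0, g ≥ 2.
private
  digitSumF : ℕ → ℕ → ℕ → ℕ
  digitSumF zero    k m = 0
  digitSumF (suc f) k zero = 0
  digitSumF (suc f) k (suc m) =
    (suc m % suc (suc k)) + digitSumF f k (suc m / suc (suc k))

s : ℕ → ℕ → ℕ
s zero          m = 0
s (suc zero)    m = 0
s (suc (suc k)) m = digitSumF m k m

ModEq : ℕ → ℕ → ℕ → Set
ModEq zero    a b = a ≡ b
ModEq (suc k) a b = a % suc k ≡ b % suc k

SquareFree : ℕ → Set
SquareFree m = ∀ p → Prime p → ¬ (p * p ∣ m)

ω : ℕ → ℕ
ω m = length (filter (λ p → prime? p ×-dec (p ∣? m)) (upTo (suc m)))

InC : ℕ → Set
InC m = Composite m × (∀ a → Coprime a m → ModEq m (a ^ (m ∸ 1)) 1)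

InC3 : ℕ → Set
InC3 m = InC m × ω m ≡ 3

InC' : ℕ → Set
InC' m = SquareFree m × 1 < m × (∀ p → Prime p → p ∣ m → s p m ≡ p)

InC'3 : ℕ → Set
InC'3 m = InC' m × ω m ≡ 3

InL : ℕ → Set
InL m = 0 < m × ∃[ g ] (g ∣ m × s g m ≡ g)

-- 𝒮: strict s-decomposition, given as a nonempty list of pairs (g_ν , e_ν)
-- with g_1 < ... < g_n, e_ν ≥ 1, 1 < g_ν < m, s_{g_ν}(m) = g_ν, m = ∏ g_ν^e_ν.
StrictSDecomp : ℕ → List (ℕ × ℕ) → Set
StrictSDecomp m ds =
  ¬ (ds ≡ [])
  × Linked _<_ (map proj₁ ds)
  × All (λ { (g , e) → 1 ≤ e × 1 < g × g < m × s g m ≡ g }) ds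
  × m ≡ product (map (λ { (g , e) → g ^ e }) ds)

InS : ℕ → Set
InS m = 0 < m × ∃[ ds ] StrictSDecomp m ds

-- A Carmichael number m is squarefree and satisfies Korselt's condition p − 1 ∣ m − 1 for every
-- prime p ∣ m: a unit x modulo p lifts to a unit y modulo m, so x ^ (m − 1) ≡ 1 (mod p) for all such x,
-- and a nonzero residue r of m − 1 modulo p − 1 is impossible because then the power sum
-- ∑_{x<p} x ^ r would be −1 modulo p, whereas the binomial theorem makes it ≡ 0 for 0 < r < p − 1.
-- For m = abc with primes a < b < c, write ab = y + xc with digits x, y < c. Then s_c(m) = x + y,
-- which is ≡ ab ≡ 1 (mod c − 1) by Korselt and lies strictly between 1 and 2c − 1, hence s_c(m) = c
-- and m ∈ ℒ. If moreover m ∉ 𝒞′₃, then s_p(m) ≠ p for p = a or b. A strict s-decomposition has a base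
-- g divisible by p with g ≠ p and g ≠ m, so g is p times one of the other two primes; using c < ab,
-- the cofactor k = m / g is smaller than g, so s_g(m) = k ≠ g.
-- The witnesses: 172081 = 7·13·31·61 is Carmichael by Korselt, is not in 𝒞′ as s_7(172081) = 19,
-- and 172081 = 31·61·91 is a strict s-decomposition; 6 lies in ℒ ∖ 𝒮 but is not Carmichael.
module Submission where

open import Defs
open import Data.List using (List; []; _∷_; length; filter; upTo)
open import Data.List.Membership.Propositional using (_∈_)
open import Data.List.Membership.Propositional.Properties using (∈-filter⁻; ∈-filter⁺; ∈-upTo⁺; ∈-map⁻)
open import Data.List.Relation.Unary.All using (All; []; _∷_; lookup; tabulate; all?)
open import Data.List.Relation.Unary.AllPairs using (AllPairs; []; _∷_; allPairs?)
import Data.List.Relation.Unary.AllPairs.Properties as AllPairs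
open import Data.List.Relation.Unary.Any using (here; there)
open import Data.List.Relation.Unary.Linked using ([-]; _∷_)
open import Data.Fin using (Fin; zero; suc; toℕ)
open import Data.Fin.Properties using (toℕ<n)
open import Data.Nat
open import Data.Nat.Combinatorics using (_C_; nCn≡1; nC1≡n; nCk≡nC[n∸k]; nCk+nC[k+1]≡[n+1]C[k+1]; k>n⇒nCk≡0)
open import Data.Nat.Coprimality using (Coprime; coprime?; coprime-divisor; 0-coprimeTo-m⇒m≡1) renaming (sym to coprime-sym)
open import Data.Nat.Divisibility
open import Data.Nat.DivMod
open import Data.Nat.Induction using (<-rec)
open import Data.Nat.ListAction using (product)
open import Data.Nat.ListAction.Properties using (∈⇒∣product)
open import Data.Nat.Primality
open import Data.Nat.Primality.Factorisation using (factorise)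
open import Data.Nat.Properties
open import Data.Nat.Tactic.RingSolver using (solve-∀)
open import Data.Product using (_×_; _,_; ∃-syntax; proj₁; proj₂)
open import Data.Sum using (_⊎_; inj₁; inj₂)
open import Data.Unit using (tt)
open import Function using (_∘_)
open import Relation.Binary.PropositionalEquality
open import Relation.Nullary using (¬_; yes; no; contradiction)
open import Relation.Nullary.Decidable using (toWitness; _×-dec_)
open import Algebra.Properties.Semiring.Sum +-*-semiring
  using (sum; sum-syntax; sum⁺-syntax; sum-cong-≗; ∑-comm; *-distribˡ-sum)
import Algebra.Definitions.RawSemiring +-*-rawSemiring as Semiringℕ
import Algebra.Properties.CommutativeSemiring.Binomial +-*-commutativeSemiring as Binomial

-- Primes and coprimality

prime⇒>1 : ∀ {p} → Prime p → 1 < p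
prime⇒>1 {p} pp = nonTrivial⇒n>1 p {{prime⇒nonTrivial pp}}

prime∣prime⇒≡ : ∀ {p q} → Prime p → Prime q → p ∣ q → p ≡ q
prime∣prime⇒≡ pp pq p∣q with prime⇒irreducible pq p∣q
... | inj₁ p≡1 = contradiction (subst Prime p≡1 pp) ¬prime[1]
... | inj₂ p≡q = p≡q

prime∤⇒coprime : ∀ {p n} → Prime p → ¬ p ∣ n → Coprime p n
prime∤⇒coprime pp p∤n (d∣p , d∣n) with prime⇒irreducible pp d∣p
... | inj₁ d≡1 = d≡1
... | inj₂ refl = contradiction d∣n p∤n

coprime-* : ∀ {a b c} → Coprime a b → Coprime a c → Coprime a (b * c)
coprime-* {b = b} a⊥b a⊥c {d} (d∣a , d∣bc) = a⊥c (d∣a , coprime-divisor d⊥b d∣bc)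
  where
  d⊥b : Coprime d b
  d⊥b (e∣d , e∣b) = a⊥b (∣-trans e∣d d∣a , e∣b)

coprime⇒*∣ : ∀ {a b n} → Coprime a b → a ∣ n → b ∣ n → a * b ∣ n
coprime⇒*∣ {a} {b} a⊥b a∣n (divides q refl) =
  *-monoˡ-∣ b (coprime-divisor a⊥b (subst (a ∣_) (*-comm q b) a∣n))

∣-^ : ∀ {g e} → 0 < e → g ∣ g ^ e
∣-^ {g} {suc e} _ = m∣m*n (g ^ e)

prime∣^⇒∣ : ∀ {p g} → Prime p → ∀ e → p ∣ g ^ e → p ∣ g
prime∣^⇒∣ pp zero p∣1 = contradiction (subst Prime (∣1⇒≡1 p∣1) pp) ¬prime[1]
prime∣^⇒∣ {g = g} pp (suc e) p∣g^[1+e] with euclidsLemma g (g ^ e) pp p∣g^[1+e]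
... | inj₁ p∣g   = p∣g
... | inj₂ p∣g^e = prime∣^⇒∣ pp e p∣g^e

prime∣product⇒∈ : ∀ {p} → Prime p → ∀ xs → p ∣ product xs → ∃[ x ] (x ∈ xs × p ∣ x)
prime∣product⇒∈ pp []       p∣1 = contradiction (subst Prime (∣1⇒≡1 p∣1) pp) ¬prime[1]
prime∣product⇒∈ pp (x ∷ xs) p∣Π with euclidsLemma x (product xs) pp p∣Π
... | inj₁ p∣x  = x , here refl , p∣x
... | inj₂ p∣Πxs with prime∣product⇒∈ pp xs p∣Πxs
...   | y , y∈xs , p∣y = y , there y∈xs , p∣y

sortedPrimes⇒product∣ : ∀ {n ps} → AllPairs _<_ ps → All Prime ps → All (_∣ n) ps → product ps ∣ n
sortedPrimes⇒product∣ []                  []             []           = 1∣ _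
sortedPrimes⇒product∣ {ps = p ∷ qs} (p<qs ∷ sorted) (pp ∷ primes) (p∣n ∷ qs∣n) =
  coprime⇒*∣ (prime∤⇒coprime pp p∤Πqs) p∣n (sortedPrimes⇒product∣ sorted primes qs∣n)
  where
  p∤Πqs : ¬ p ∣ product qs
  p∤Πqs p∣Πqs with prime∣product⇒∈ pp qs p∣Πqs
  ... | q , q∈qs , p∣q = <⇒≢ (lookup p<qs q∈qs) (prime∣prime⇒≡ pp (lookup primes q∈qs) p∣q)

noPrimeFactor⇒≡1 : ∀ {q} .{{_ : NonZero q}} → (∀ r → Prime r → ¬ r ∣ q) → q ≡ 1
noPrimeFactor⇒≡1 {q} r∤q with factorise q
... | record { factors = [] ; isFactorisation = q≡1 } = q≡1
... | record { factors = r ∷ rs ; isFactorisation = q≡Π ; factorsPrime = pr ∷ _ } =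
  contradiction (subst (r ∣_) (sym q≡Π) (m∣m*n (product rs))) (r∤q r pr)

∣p*q⇒ : ∀ {p q d} → Prime p → Prime q → d ∣ p * q → d ≡ 1 ⊎ d ≡ p ⊎ d ≡ q ⊎ d ≡ p * q
∣p*q⇒ {p} {q} {d} pp pq d∣pq with p ∣? d
... | yes (divides k d≡k*p) with prime⇒irreducible pq k∣q
  where
  k∣q : k ∣ q
  k∣q = *-cancelʳ-∣ {k} {q} p {{prime⇒nonZero pp}} (subst (_∣ q * p) d≡k*p (subst (d ∣_) (*-comm p q) d∣pq))
...   | inj₁ k≡1 = inj₂ (inj₁ (trans d≡k*p (trans (cong (_* p) k≡1) (*-identityˡ p))))
...   | inj₂ k≡q = inj₂ (inj₂ (inj₂ (trans d≡k*p (trans (cong (_* p) k≡q) (*-comm q p)))))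
∣p*q⇒ {p} {q} {d} pp pq d∣pq | no p∤d
  with prime⇒irreducible pq (coprime-divisor (coprime-sym (prime∤⇒coprime pp p∤d)) d∣pq)
...   | inj₁ d≡1 = inj₁ d≡1
...   | inj₂ d≡q = inj₂ (inj₂ (inj₁ d≡q))

-- Congruences

%-cong-+ : ∀ {a b c d n} .{{_ : NonZero n}} → a % n ≡ b % n → c % n ≡ d % n → (a + c) % n ≡ (b + d) % n
%-cong-+ {a} {b} {c} {d} {n} a≡b c≡d = begin
  (a + c) % n           ≡⟨ %-distribˡ-+ a c n ⟩
  (a % n + c % n) % n   ≡⟨ cong₂ (λ u v → (u + v) % n) a≡b c≡d ⟩
  (b % n + d % n) % n   ≡⟨ %-distribˡ-+ b d n ⟨
  (b + d) % n           ∎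
  where open ≡-Reasoning

%-cong-* : ∀ {a b c d n} .{{_ : NonZero n}} → a % n ≡ b % n → c % n ≡ d % n → (a * c) % n ≡ (b * d) % n
%-cong-* {a} {b} {c} {d} {n} a≡b c≡d = begin
  (a * c) % n             ≡⟨ %-distribˡ-* a c n ⟩
  (a % n * (c % n)) % n   ≡⟨ cong₂ (λ u v → (u * v) % n) a≡b c≡d ⟩
  (b % n * (d % n)) % n   ≡⟨ %-distribˡ-* b d n ⟨
  (b * d) % n             ∎
  where open ≡-Reasoning

%-cong-^ : ∀ {a b n} .{{_ : NonZero n}} k → a % n ≡ b % n → a ^ k % n ≡ b ^ k % n
%-cong-^ zero    a≡b = refl
%-cong-^ (suc k) a≡b = %-cong-* a≡b (%-cong-^ k a≡b)

%≡%⇒∣∸ : ∀ {a b n} .{{_ : NonZero n}} → a % n ≡ b % n → b ≤ a → n ∣ a ∸ b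
%≡%⇒∣∸ {a} {b} {n} a≡b b≤a = divides (a / n ∸ b / n) (begin
  a ∸ b                                       ≡⟨ cong₂ _∸_ (m≡m%n+[m/n]*n a n) (m≡m%n+[m/n]*n b n) ⟩
  (a % n + a / n * n) ∸ (b % n + b / n * n)   ≡⟨ cong (λ r → (r + a / n * n) ∸ (b % n + b / n * n)) a≡b ⟩
  (b % n + a / n * n) ∸ (b % n + b / n * n)   ≡⟨ [m+n]∸[m+o]≡n∸o (b % n) (a / n * n) (b / n * n) ⟩
  a / n * n ∸ b / n * n                       ≡⟨ *-distribʳ-∸ n (a / n) (b / n) ⟨
  (a / n ∸ b / n) * n                         ∎)
  where open ≡-Reasoning

∣∸⇒%≡% : ∀ {a b n} .{{_ : NonZero n}} → b ≤ a → n ∣ a ∸ b → a % n ≡ b % n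
∣∸⇒%≡% {a} {b} b≤a n∣a∸b = trans (cong (_% _) (sym (m+[n∸m]≡n b≤a))) (%-remove-+ʳ b n∣a∸b)

ModEq⇒%≡% : ∀ {m a b} .{{_ : NonZero m}} → ModEq m a b → a % m ≡ b % m
ModEq⇒%≡% {suc _} a≡b = a≡b

%≡%⇒ModEq : ∀ {m a b} .{{_ : NonZero m}} → a % m ≡ b % m → ModEq m a b
%≡%⇒ModEq {suc _} a≡b = a≡b

-- Finite sums and binomial coefficients

∑-∣ : ∀ {d} n (f : Fin n → ℕ) → (∀ i → d ∣ f i) → d ∣ sum f
∑-∣ zero    f d∣f = _ ∣0
∑-∣ (suc n) f d∣f = ∣m∣n⇒∣m+n (d∣f zero) (∑-∣ n (f ∘ suc) (d∣f ∘ suc))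

∑-cong-% : ∀ {m} .{{_ : NonZero m}} n (f g : Fin n → ℕ) → (∀ i → f i % m ≡ g i % m) → sum f % m ≡ sum g % m
∑-cong-% zero    f g f≡g = refl
∑-cong-% (suc n) f g f≡g = %-cong-+ (f≡g zero) (∑-cong-% n (f ∘ suc) (g ∘ suc) (f≡g ∘ suc))

∑-init-last : ∀ n (f : ℕ → ℕ) → ∑[ i < suc n ] f (toℕ i) ≡ ∑[ i < n ] f (toℕ i) + f n
∑-init-last zero    f = +-comm (f 0) 0
∑-init-last (suc n) f =
  trans (cong (f 0 +_) (∑-init-last n (λ j → f (suc j)))) (sym (+-assoc (f 0) _ (f (suc n))))

∑-one : ∀ n → ∑[ i < n ] 1 ≡ n
∑-one zero    = refl
∑-one (suc n) = cong suc (∑-one n)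

binomial-theorem : ∀ x n → suc x ^ n ≡ ∑[ k ≤ n ] ((n C toℕ k) * x ^ toℕ k)
binomial-theorem x n = begin
  suc x ^ n                         ≡⟨ cong (_^ n) (+-comm 1 x) ⟩
  (x + 1) ^ n                       ≡⟨ ^≡^ (x + 1) n ⟨
  (x + 1) Semiringℕ.^ n             ≡⟨ Binomial.theorem n x 1 ⟩
  Binomial.binomialExpansion x 1 n  ≡⟨ sum-cong-≗ term ⟩
  ∑[ k ≤ n ] ((n C toℕ k) * x ^ toℕ k) ∎
  where
  open ≡-Reasoning
  ^≡^ : ∀ y m → y Semiringℕ.^ m ≡ y ^ m
  ^≡^ y zero    = refl
  ^≡^ y (suc m) = cong (y *_) (^≡^ y m)
  ×≡* : ∀ m y → m Semiringℕ.× y ≡ m * y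
  ×≡* zero    y = refl
  ×≡* (suc m) y = cong (y +_) (×≡* m y)
  term : ∀ k → Binomial.binomialTerm x 1 n k ≡ (n C toℕ k) * x ^ toℕ k
  term k = trans (×≡* (n C toℕ k) _) (cong ((n C toℕ k) *_) (begin
    x Semiringℕ.^ toℕ k * 1 Semiringℕ.^ (n ∸ toℕ k) ≡⟨ cong₂ _*_ (^≡^ x (toℕ k)) (^≡^ 1 (n ∸ toℕ k)) ⟩
    x ^ toℕ k * 1 ^ (n ∸ toℕ k)                     ≡⟨ cong (x ^ toℕ k *_) (^-zeroˡ (n ∸ toℕ k)) ⟩
    x ^ toℕ k * 1                                   ≡⟨ *-identityʳ (x ^ toℕ k) ⟩
    x ^ toℕ k                                       ∎))

[1+k]*[1+n]C[1+k]≡[1+n]*nCk : ∀ n k → suc k * (suc n C suc k) ≡ suc n * (n C k)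
[1+k]*[1+n]C[1+k]≡[1+n]*nCk zero    zero    = refl
[1+k]*[1+n]C[1+k]≡[1+n]*nCk zero    (suc k) = begin
  suc (suc k) * (1 C suc (suc k))  ≡⟨ cong (suc (suc k) *_) (k>n⇒nCk≡0 {1} {suc (suc k)} (s≤s (s≤s z≤n))) ⟩
  suc (suc k) * 0                  ≡⟨ *-zeroʳ (suc (suc k)) ⟩
  0                                ≡⟨ cong (1 *_) (k>n⇒nCk≡0 {0} {suc k} (s≤s z≤n)) ⟨
  1 * (0 C suc k)                  ∎
  where open ≡-Reasoning
[1+k]*[1+n]C[1+k]≡[1+n]*nCk (suc n) zero    =
  trans (+-identityʳ (suc (suc n) C 1)) (trans (nC1≡n (suc (suc n))) (sym (*-identityʳ (suc (suc n)))))
[1+k]*[1+n]C[1+k]≡[1+n]*nCk (suc n) (suc k) = begin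
  suc (suc k) * (suc (suc n) C suc (suc k))                   ≡⟨ cong (suc (suc k) *_) (nCk+nC[k+1]≡[n+1]C[k+1] (suc n) (suc k)) ⟨
  suc (suc k) * (suc n C suc k + suc n C suc (suc k))         ≡⟨ spread k (suc n C suc k) (suc n C suc (suc k)) ⟩
  suc k * (suc n C suc k) + suc n C suc k + suc (suc k) * (suc n C suc (suc k))
    ≡⟨ cong₂ (λ u v → u + suc n C suc k + v) ([1+k]*[1+n]C[1+k]≡[1+n]*nCk n k) ([1+k]*[1+n]C[1+k]≡[1+n]*nCk n (suc k)) ⟩
  suc n * (n C k) + suc n C suc k + suc n * (n C suc k)      ≡⟨ collect n (n C k) (n C suc k) (suc n C suc k) ⟩
  suc n * (n C k + n C suc k) + suc n C suc k                 ≡⟨ cong (λ t → suc n * t + suc n C suc k) (nCk+nC[k+1]≡[n+1]C[k+1] n k) ⟩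
  suc n * (suc n C suc k) + suc n C suc k                     ≡⟨ +-comm (suc n * (suc n C suc k)) _ ⟩
  suc (suc n) * (suc n C suc k)                               ∎
  where
  open ≡-Reasoning
  spread : ∀ k a b → suc (suc k) * (a + b) ≡ suc k * a + a + suc (suc k) * b
  spread = solve-∀
  collect : ∀ n a b c → suc n * a + c + suc n * b ≡ suc n * (a + b) + c
  collect = solve-∀

[1+n]Cn≡1+n : ∀ n → suc n C n ≡ suc n
[1+n]Cn≡1+n n = trans (nCk≡nC[n∸k] (n≤1+n n)) (trans (cong (suc n C_) (m+n∸n≡m 1 n)) (nC1≡n (suc n)))

prime∣pCk : ∀ {p k} → Prime p → 0 < k → k < p → p ∣ p C k
prime∣pCk {suc n} {suc k} pp _ k<p with euclidsLemma (suc k) (suc n C suc k) pp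
  (divides (n C k) (trans ([1+k]*[1+n]C[1+k]≡[1+n]*nCk n k) (*-comm (suc n) (n C k))))
... | inj₁ p∣k = contradiction p∣k (>⇒∤ k<p)
... | inj₂ p∣C = p∣C

-- Fermat's little theorem

[1+x]^p≡1+x^p : ∀ {p} .{{_ : NonZero p}} → Prime p → ∀ x → suc x ^ p % p ≡ (1 + x ^ p) % p
[1+x]^p≡1+x^p {p@(suc q)} pp x = begin
  suc x ^ p % p                                       ≡⟨ cong (_% p) (binomial-theorem x p) ⟩
  (1 + ∑[ k < p ] middle (toℕ k)) % p                ≡⟨ cong (λ t → (1 + t) % p) (∑-init-last q middle) ⟩
  (1 + (∑[ k < q ] middle (toℕ k) + middle q)) % p   ≡⟨ cong (λ t → (1 + (∑[ k < q ] middle (toℕ k) + t * x ^ p)) % p) (nCn≡1 p) ⟩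
  (1 + (M + 1 * x ^ p)) % p                           ≡⟨ cong (_% p) (rearrange M (x ^ p)) ⟩
  (1 + x ^ p + M) % p                                 ≡⟨ %-remove-+ʳ (1 + x ^ p) p∣M ⟩
  (1 + x ^ p) % p                                     ∎
  where
  open ≡-Reasoning
  middle : ℕ → ℕ
  middle k = (p C suc k) * x ^ suc k
  M = ∑[ k < q ] middle (toℕ k)
  p∣M : p ∣ M
  p∣M = ∑-∣ q _ (λ k → ∣m⇒∣m*n (x ^ suc (toℕ k)) (prime∣pCk pp (s≤s z≤n) (s≤s (toℕ<n k))))
  rearrange : ∀ a b → 1 + (a + 1 * b) ≡ 1 + b + a
  rearrange = solve-∀

x^p≡x : ∀ {p} .{{_ : NonZero p}} → Prime p → ∀ x → x ^ p % p ≡ x % p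
x^p≡x {suc q} pp zero    = refl
x^p≡x {suc q} pp (suc x) = trans ([1+x]^p≡1+x^p pp x) (%-cong-+ {1} {1} refl (x^p≡x pp x))

fermat : ∀ {p x} .{{_ : NonZero p}} → Prime p → ¬ p ∣ x → x ^ (p ∸ 1) % p ≡ 1 % p
fermat {suc q} {x} pp p∤x = ∣∸⇒%≡% 1≤y p∣y∸1
  where
  instance
    x≢0 : NonZero x
    x≢0 = ≢-nonZero (λ x≡0 → p∤x (subst (suc q ∣_) (sym x≡0) (suc q ∣0)))
  y = x ^ q
  1≤y : 1 ≤ y
  1≤y = m^n>0 x q
  p∣x*[y∸1] : suc q ∣ x * (y ∸ 1)
  p∣x*[y∸1] = subst (suc q ∣_) (sym (*-distribˡ-∸ x y 1))
    (%≡%⇒∣∸ (trans (x^p≡x pp x) (cong (_% suc q) (sym (*-identityʳ x)))) (*-monoʳ-≤ x 1≤y))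
  p∣y∸1 : suc q ∣ y ∸ 1
  p∣y∸1 with euclidsLemma x (y ∸ 1) pp p∣x*[y∸1]
  ... | inj₁ p∣x   = contradiction p∣x p∤x
  ... | inj₂ p∣y∸1 = p∣y∸1

fermat-∣ : ∀ {p x e} .{{_ : NonZero p}} → Prime p → ¬ p ∣ x → (p ∸ 1) ∣ e → x ^ e % p ≡ 1 % p
fermat-∣ {p} {x} pp p∤x (divides q refl) = begin
  x ^ (q * (p ∸ 1)) % p   ≡⟨ cong (λ e → x ^ e % p) (*-comm q (p ∸ 1)) ⟩
  x ^ ((p ∸ 1) * q) % p   ≡⟨ cong (_% p) (^-*-assoc x (p ∸ 1) q) ⟨
  (x ^ (p ∸ 1)) ^ q % p   ≡⟨ %-cong-^ q (fermat pp p∤x) ⟩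
  1 ^ q % p               ≡⟨ cong (_% p) (^-zeroˡ q) ⟩
  1 % p                   ∎
  where open ≡-Reasoning

-- Power sums modulo a prime

powerSum : ℕ → ℕ → ℕ
powerSum c j = ∑[ x < c ] (toℕ x ^ j)

-- Telescoping: the sum over x < c of (x + 1) ^ n − x ^ n is c ^ n; expand (x + 1) ^ n binomially.
powerSum-binomial : ∀ c j → ∑[ i < suc j ] ((suc j C toℕ i) * powerSum c (toℕ i)) ≡ c ^ suc j
powerSum-binomial c j = +-cancelʳ-≡ (powerSum c n) _ _ (begin
  S + powerSum c n                                         ≡⟨ cong (S +_) (*-identityˡ (powerSum c n)) ⟨
  S + 1 * powerSum c n                                     ≡⟨ cong (λ t → S + t * powerSum c n) (nCn≡1 n) ⟨
  S + (n C n) * powerSum c n                               ≡⟨ ∑-init-last n (λ i → (n C i) * powerSum c i) ⟨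
  ∑[ i ≤ n ] ((n C toℕ i) * powerSum c (toℕ i))           ≡⟨ sum-cong-≗ distribute ⟩
  ∑[ i ≤ n ] ∑[ x < c ] ((n C toℕ i) * toℕ x ^ toℕ i)     ≡⟨ ∑-comm {c} {suc n} (λ x i → (n C toℕ i) * toℕ x ^ toℕ i) ⟨
  ∑[ x < c ] ∑[ i ≤ n ] ((n C toℕ i) * toℕ x ^ toℕ i)     ≡⟨ sum-cong-≗ expand ⟨
  ∑[ x < c ] (suc (toℕ x) ^ n)                           ≡⟨ ∑-init-last c (_^ n) ⟩
  powerSum c n + c ^ n                                     ≡⟨ +-comm (powerSum c n) (c ^ n) ⟩
  c ^ n + powerSum c n                                     ∎)
  where
  open ≡-Reasoning
  n = suc j
  S = ∑[ i < n ] ((n C toℕ i) * powerSum c (toℕ i))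
  distribute : ∀ (i : Fin (suc n)) → (n C toℕ i) * powerSum c (toℕ i) ≡ ∑[ x < c ] ((n C toℕ i) * toℕ x ^ toℕ i)
  distribute i = *-distribˡ-sum {c} (n C toℕ i) (λ x → toℕ x ^ toℕ i)
  expand : ∀ (x : Fin c) → suc (toℕ x) ^ n ≡ ∑[ i ≤ n ] ((n C toℕ i) * toℕ x ^ toℕ i)
  expand x = binomial-theorem (toℕ x) n

-- Strong induction on j: in powerSum-binomial every term with i < j is a multiple of c,
-- which leaves c ∣ (j + 1) * powerSum c j, and j + 1 < c.
prime∣powerSum : ∀ {c} → Prime c → ∀ j → 0 < j → suc j < c → c ∣ powerSum c j
prime∣powerSum {c} pc = <-rec P step
  where
  P : ℕ → Set
  P j = 0 < j → suc j < c → c ∣ powerSum c j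
  step : ∀ j → (∀ {i} → i < j → P i) → P j
  step j rec _ j+1<c with euclidsLemma (suc j) (powerSum c j) pc c∣[1+j]*Tⱼ
    where
    term : ℕ → ℕ
    term i = (suc j C i) * powerSum c i
    c∣term : ∀ i → i < j → c ∣ term i
    c∣term zero    _   = ∣n⇒∣m*n (suc j C 0) (subst (c ∣_) (sym (∑-one c)) ∣-refl)
    c∣term (suc i) i<j = ∣n⇒∣m*n (suc j C suc i) (rec i<j (s≤s z≤n) (<-trans (s≤s i<j) j+1<c))
    c∣total : c ∣ ∑[ i < j ] term (toℕ i) + term j
    c∣total = subst (c ∣_) (trans (sym (powerSum-binomial c j)) (∑-init-last j term)) (m∣m*n (c ^ j))
    c∣[1+j]*Tⱼ : c ∣ suc j * powerSum c j
    c∣[1+j]*Tⱼ = subst (λ t → c ∣ t * powerSum c j) ([1+n]Cn≡1+n j)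
      (∣m+n∣m⇒∣n c∣total (∑-∣ j _ (λ i → c∣term (toℕ i) (toℕ<n i))))
  ... | inj₁ c∣1+j = contradiction c∣1+j (>⇒∤ j+1<c)
  ... | inj₂ c∣Tⱼ  = c∣Tⱼ

¬∀x^r≡1 : ∀ {c r} .{{_ : NonZero c}} → Prime c → 0 < r → suc r < c →
          ¬ (∀ x → 0 < x → x < c → x ^ r % c ≡ 1 % c)
¬∀x^r≡1 {c@(suc c')} {r@(suc _)} pc _ r+1<c x^r≡1 =
  contradiction (subst (λ t → 1 < suc t) c'≡0 (prime⇒>1 pc)) (<-irrefl refl)
  where
  open ≡-Reasoning
  c'≡0 : c' ≡ 0
  c'≡0 = begin
    c'                                ≡⟨ m<n⇒m%n≡m (n<1+n c') ⟨
    c' % c                            ≡⟨ cong (_% c) (∑-one c') ⟨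
    (∑[ x < c' ] 1) % c               ≡⟨ ∑-cong-% c' _ _ (λ x → sym (x^r≡1 (suc (toℕ x)) (s≤s z≤n) (s≤s (toℕ<n x)))) ⟩
    (∑[ x < c' ] (suc (toℕ x) ^ r)) % c ≡⟨ n∣m⇒m%n≡0 (powerSum c r) c (prime∣powerSum pc r (s≤s z≤n) r+1<c) ⟩
    0                                 ∎

x^e≡1⇒[c∸1]∣e : ∀ {c e} .{{_ : NonZero c}} → Prime c → (∀ x → 0 < x → x < c → x ^ e % c ≡ 1 % c) → (c ∸ 1) ∣ e
x^e≡1⇒[c∸1]∣e {c@(suc (suc d'))} {e} pc x^e≡1 with e % suc d' in e%d≡r
... | zero   = m%n≡0⇒n∣m e (suc d') e%d≡r
... | suc r' = contradiction (subst (λ r → ∀ x → 0 < x → x < c → x ^ r % c ≡ 1 % c) e%d≡r x^[e%d]≡1)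
                             (¬∀x^r≡1 pc (s≤s z≤n) (s≤s (subst (_< d) e%d≡r (m%n<n e d))))
  where
  d = suc d'
  x^[e%d]≡1 : ∀ x → 0 < x → x < c → x ^ (e % d) % c ≡ 1 % c
  x^[e%d]≡1 x 0<x x<c = begin
    x ^ (e % d) % c                         ≡⟨ cong (_% c) (*-identityʳ (x ^ (e % d))) ⟨
    x ^ (e % d) * 1 % c                     ≡⟨ %-cong-* {x ^ (e % d)} {x ^ (e % d)} {1} {x ^ (e / d * d)} refl
                                                 (sym (fermat-∣ pc c∤x (divides (e / d) refl))) ⟩
    x ^ (e % d) * x ^ (e / d * d) % c       ≡⟨ cong (_% c) (^-distribˡ-+-* x (e % d) (e / d * d)) ⟨
    x ^ (e % d + e / d * d) % c             ≡⟨ cong (λ t → x ^ t % c) (m≡m%n+[m/n]*n e d) ⟨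
    x ^ e % c                               ≡⟨ x^e≡1 x 0<x x<c ⟩
    1 % c                                   ∎
    where
    open ≡-Reasoning
    c∤x : ¬ c ∣ x
    c∤x = >⇒∤ {{>-nonZero 0<x}} x<c

-- Carmichael numbers and Korselt's criterion

[1+t]^j≡1+j*t : ∀ {m t} .{{_ : NonZero m}} → m ∣ t * t → ∀ j → (1 + t) ^ j % m ≡ (1 + j * t) % m
[1+t]^j≡1+j*t m∣t² zero    = refl
[1+t]^j≡1+j*t {m} {t} m∣t² (suc j) = begin
  (1 + t) * (1 + t) ^ j % m          ≡⟨ %-cong-* {1 + t} refl ([1+t]^j≡1+j*t m∣t² j) ⟩
  (1 + t) * (1 + j * t) % m          ≡⟨ cong (_% m) (expand t j) ⟩
  (1 + suc j * t + j * (t * t)) % m  ≡⟨ %-remove-+ʳ (1 + suc j * t) (∣n⇒∣m*n j m∣t²) ⟩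
  (1 + suc j * t) % m                ∎
  where
  open ≡-Reasoning
  expand : ∀ t j → (1 + t) * (1 + j * t) ≡ 1 + suc j * t + j * (t * t)
  expand = solve-∀

-- If p * p ∣ m, then t = m / p satisfies m ∣ t * t, so (1 + t) ^ (m ∸ 1) ≡ 1 + (m ∸ 1) * t ≡ 1 − t.
carmichael⇒squareFree : ∀ {m} → InC m → SquareFree m
carmichael⇒squareFree {zero}  (0-composite , _) _ _ _ = contradiction 0-composite ¬composite[0]
carmichael⇒squareFree {m@(suc k)} (_ , carmichael) p pp (divides w m≡w*p²) = contradiction m∣t (>⇒∤ t<m)
  where
  t = w * p
  m≡t*p : m ≡ t * p
  m≡t*p = trans m≡w*p² (sym (*-assoc w p p))
  instance
    t≢0 : NonZero t
    t≢0 = ≢-nonZero (λ t≡0 → 1+n≢0 (trans m≡t*p (cong (_* p) t≡0)))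
  t<m : t < m
  t<m = subst (t <_) (sym m≡t*p) (m<m*n t p (prime⇒>1 pp))
  m∣t² : m ∣ t * t
  m∣t² = divides w (trans (square w p) (cong (w *_) (sym m≡w*p²)))
    where
    square : ∀ w p → w * p * (w * p) ≡ w * (w * (p * p))
    square = solve-∀
  1+t⊥m : Coprime (1 + t) m
  1+t⊥m {d} (d∣1+t , d∣m) = ∣1⇒≡1 (∣m+n∣m⇒∣n (subst (d ∣_) (+-comm 1 t) d∣1+t) d∣t)
    where
    d∣t : d ∣ t
    d∣t = ∣m+n∣m⇒∣n (subst (d ∣_) (trans (*-suc t t) (+-comm t (t * t))) (∣n⇒∣m*n t d∣1+t)) (∣-trans d∣m m∣t²)
  m∣k*t : m ∣ k * t
  m∣k*t = subst (m ∣_) (m+n∸m≡n 1 (k * t))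
    (%≡%⇒∣∸ (trans (sym ([1+t]^j≡1+j*t m∣t² k)) (carmichael (1 + t) 1+t⊥m)) (s≤s z≤n))
  m∣t : m ∣ t
  m∣t = ∣m+n∣m⇒∣n (subst (m ∣_) (+-comm t (k * t)) (m∣m*n t)) m∣k*t

-- y = 1 + (x ∸ 1) * n ^ (p ∸ 1) is ≡ x (mod p) by Fermat and ≡ 1 (mod n), so no inverse of n modulo p
-- is needed.
unitLift : ∀ {p n x} .{{_ : NonZero p}} → Prime p → ¬ p ∣ n → 0 < x → x < p →
           ∃[ y ] (y % p ≡ x % p × Coprime y (n * p))
unitLift {p} {n} {x} pp p∤n 0<x x<p = y , y≡x , coprime-* y⊥n y⊥p
  where
  open ≡-Reasoning
  y = 1 + (x ∸ 1) * n ^ (p ∸ 1)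
  y≡x : y % p ≡ x % p
  y≡x = begin
    (1 + (x ∸ 1) * n ^ (p ∸ 1)) % p  ≡⟨ %-cong-+ {1} {1} {(x ∸ 1) * n ^ (p ∸ 1)} {(x ∸ 1) * 1} refl
                                          (%-cong-* {x ∸ 1} {x ∸ 1} {n ^ (p ∸ 1)} {1} refl (fermat pp p∤n)) ⟩
    (1 + (x ∸ 1) * 1) % p            ≡⟨ cong (λ t → (1 + t) % p) (*-identityʳ (x ∸ 1)) ⟩
    (1 + (x ∸ 1)) % p                ≡⟨ cong (_% p) (m+[n∸m]≡n 0<x) ⟩
    x % p                            ∎
  y⊥n : Coprime y n
  y⊥n {d} (d∣y , d∣n) = ∣1⇒≡1 (∣m+n∣m⇒∣n (subst (d ∣_) (+-comm 1 _) d∣y)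
    (∣n⇒∣m*n (x ∸ 1) (∣-trans d∣n (∣-^ (m<n⇒0<n∸m (prime⇒>1 pp))))))
  p∤y : ¬ p ∣ y
  p∤y p∣y = <⇒≢ 0<x (sym (trans (sym (m<n⇒m%n≡m x<p)) (trans (sym y≡x) (n∣m⇒m%n≡0 y p p∣y))))
  y⊥p : Coprime y p
  y⊥p = coprime-sym (prime∤⇒coprime pp p∤y)

carmichael⇒korselt : ∀ {m p} → InC m → Prime p → p ∣ m → (p ∸ 1) ∣ (m ∸ 1)
carmichael⇒korselt {m} {p} carm@(m-composite , carmichael) pp p∣m@(divides n m≡n*p) = x^e≡1⇒[c∸1]∣e pp x^[m∸1]≡1
  where
  instance
    p≢0 : NonZero p
    p≢0 = prime⇒nonZero pp
    m≢0 : NonZero m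
    m≢0 = composite⇒nonZero m-composite
  p∤n : ¬ p ∣ n
  p∤n (divides w n≡w*p) =
    carmichael⇒squareFree carm p pp (divides w (trans m≡n*p (trans (cong (_* p) n≡w*p) (*-assoc w p p))))
  x^[m∸1]≡1 : ∀ x → 0 < x → x < p → x ^ (m ∸ 1) % p ≡ 1 % p
  x^[m∸1]≡1 x 0<x x<p with unitLift pp p∤n 0<x x<p
  ... | y , y≡x , y⊥n*p = begin
    x ^ (m ∸ 1) % p      ≡⟨ %-cong-^ (m ∸ 1) y≡x ⟨
    y ^ (m ∸ 1) % p      ≡⟨ m∣n⇒o%n%m≡o%m p m (y ^ (m ∸ 1)) p∣m ⟨
    y ^ (m ∸ 1) % m % p  ≡⟨ cong (_% p) (ModEq⇒%≡% (carmichael y (subst (Coprime y) (sym m≡n*p) y⊥n*p))) ⟩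
    1 % m % p            ≡⟨ m∣n⇒o%n%m≡o%m p m 1 p∣m ⟩
    1 % p                ∎
    where open ≡-Reasoning

korselt⇒carmichael : ∀ {ps} → AllPairs _<_ ps → All Prime ps → All (λ p → (p ∸ 1) ∣ (product ps ∸ 1)) ps →
                     ∀ a → Coprime a (product ps) → ModEq (product ps) (a ^ (product ps ∸ 1)) 1
korselt⇒carmichael sorted primes korselt zero 0⊥Πps rewrite 0-coprimeTo-m⇒m≡1 0⊥Πps = refl
korselt⇒carmichael {ps} sorted primes korselt a@(suc _) a⊥Πps =
  %≡%⇒ModEq (∣∸⇒%≡% (m^n>0 a (product ps ∸ 1)) (sortedPrimes⇒product∣ sorted primes (tabulate p∣a^e∸1)))
  where
  instance
    Πps≢0 : NonZero (product ps)
    Πps≢0 = productOfPrimes≢0 primes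
  p∣a^e∸1 : ∀ {p} → p ∈ ps → p ∣ a ^ (product ps ∸ 1) ∸ 1
  p∣a^e∸1 {p} p∈ps = %≡%⇒∣∸ (fermat-∣ pp p∤a (lookup korselt p∈ps)) (m^n>0 a (product ps ∸ 1))
    where
    pp = lookup primes p∈ps
    instance
      p≢0 : NonZero p
      p≢0 = prime⇒nonZero pp
    p∤a : ¬ p ∣ a
    p∤a p∣a = contradiction (subst Prime (a⊥Πps (p∣a , ∈⇒∣product p∈ps)) pp) ¬prime[1]

-- Squarefree numbers with three prime factors

squareFree⇒≡product : ∀ {m ps} .{{_ : NonZero m}} → SquareFree m → AllPairs _<_ ps → All Prime ps →
                      All (_∣ m) ps → (∀ {p} → Prime p → p ∣ m → p ∈ ps) → m ≡ product ps
squareFree⇒≡product {m} {ps} squarefree sorted primes ps∣m covers = begin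
  m                  ≡⟨ m∣n⇒n≡quotient*m Π∣m ⟩
  q * product ps     ≡⟨ cong (_* product ps) (noPrimeFactor⇒≡1 {{quotient≢0 Π∣m}} r∤q) ⟩
  1 * product ps     ≡⟨ *-identityˡ (product ps) ⟩
  product ps         ∎
  where
  open ≡-Reasoning
  Π∣m = sortedPrimes⇒product∣ sorted primes ps∣m
  q = quotient Π∣m
  -- A prime factor r of the cofactor q is one of ps, so r * r divides q * product ps = m.
  r∤q : ∀ r → Prime r → ¬ r ∣ q
  r∤q r pr r∣q = squarefree r pr (subst (r * r ∣_) (sym (m∣n⇒n≡quotient*m Π∣m))
    (*-pres-∣ r∣q (∈⇒∣product (covers pr (∣-trans r∣q (quotient-∣ Π∣m))))))

primeDivisors : ℕ → List ℕ
primeDivisors m = filter (λ p → prime? p ×-dec (p ∣? m)) (upTo (suc m))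

∈-primeDivisors⁻ : ∀ {m p} → p ∈ primeDivisors m → Prime p × p ∣ m
∈-primeDivisors⁻ {m} p∈ = proj₂ (∈-filter⁻ (λ p → prime? p ×-dec (p ∣? m)) {xs = upTo (suc m)} p∈)

∈-primeDivisors⁺ : ∀ {m p} .{{_ : NonZero m}} → Prime p → p ∣ m → p ∈ primeDivisors m
∈-primeDivisors⁺ {m} pp p∣m = ∈-filter⁺ (λ p → prime? p ×-dec (p ∣? m)) (∈-upTo⁺ (s≤s (∣⇒≤ p∣m))) (pp , p∣m)

primeDivisors-sorted : ∀ m → AllPairs _<_ (primeDivisors m)
primeDivisors-sorted m =
  AllPairs.filter⁺ (λ p → prime? p ×-dec (p ∣? m)) (AllPairs.applyUpTo⁺₁ (λ x → x) (suc m) (λ i<j _ → i<j))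

record PrimeTriple (m : ℕ) : Set where
  field
    a b c           : ℕ
    a<b             : a < b
    b<c             : b < c
    prime-a         : Prime a
    prime-b         : Prime b
    prime-c         : Prime c
    m≡abc           : m ≡ a * b * c
    primeFactor∈abc : ∀ {p} → Prime p → p ∣ m → p ≡ a ⊎ p ≡ b ⊎ p ≡ c

sortedPrimeTriple : ∀ {m} (ps : List ℕ) → length ps ≡ 3 → AllPairs _<_ ps → All Prime ps →
                    m ≡ product ps → (∀ {p} → Prime p → p ∣ m → p ∈ ps) → PrimeTriple m
sortedPrimeTriple (a ∷ b ∷ c ∷ []) _ ((a<b ∷ _) ∷ (b<c ∷ []) ∷ [] ∷ []) (pa ∷ pb ∷ pc ∷ []) m≡abc1 covers = record
  { a<b = a<b ; b<c = b<c ; prime-a = pa ; prime-b = pb ; prime-c = pc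
  ; m≡abc = trans m≡abc1 (reassociate a b c)
  ; primeFactor∈abc = λ pp p∣m → ∈[a,b,c] (covers pp p∣m)
  }
  where
  reassociate : ∀ a b c → a * (b * (c * 1)) ≡ a * b * c
  reassociate = solve-∀
  ∈[a,b,c] : ∀ {p} → p ∈ a ∷ b ∷ c ∷ [] → p ≡ a ⊎ p ≡ b ⊎ p ≡ c
  ∈[a,b,c] (here p≡a)                 = inj₁ p≡a
  ∈[a,b,c] (there (here p≡b))         = inj₂ (inj₁ p≡b)
  ∈[a,b,c] (there (there (here p≡c))) = inj₂ (inj₂ p≡c)

squareFree∧ω≡3⇒primeTriple : ∀ {m} .{{_ : NonZero m}} → SquareFree m → ω m ≡ 3 → PrimeTriple m
squareFree∧ω≡3⇒primeTriple {m} squarefree ω≡3 =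
  sortedPrimeTriple (primeDivisors m) ω≡3 sorted primes
    (squareFree⇒≡product squarefree sorted primes divisors ∈-primeDivisors⁺) ∈-primeDivisors⁺
  where
  sorted = primeDivisors-sorted m
  primes = tabulate (λ p∈ → proj₁ (∈-primeDivisors⁻ {m} p∈))
  divisors = tabulate (λ p∈ → proj₂ (∈-primeDivisors⁻ {m} p∈))

-- Digit sums

[y+x*g]%g≡y : ∀ {g} .{{_ : NonZero g}} x {y} → y < g → (y + x * g) % g ≡ y
[y+x*g]%g≡y {g} x {y} y<g = trans ([m+kn]%n≡m%n y x g) (m<n⇒m%n≡m y<g)

[y+x*g]/g≡x : ∀ {g} .{{_ : NonZero g}} x {y} → y < g → (y + x * g) / g ≡ x
[y+x*g]/g≡x {g} x {y} y<g = trans (+-distrib-/-∣ʳ y (divides-refl x)) (cong₂ _+_ (m<n⇒m/n≡0 y<g) (m*n/n≡m x g))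

-- s unfolds with fuel equal to its argument, so the digits of (y + x * g) * g are peeled off one
-- division at a time, exposing each intermediate fuel value by a case split.
s[[y+x*g]*g]≡y+x : ∀ {g x y} → 1 < g → x < g → y < g → s g ((y + x * g) * g) ≡ y + x
s[[y+x*g]*g]≡y+x {g@(suc (suc k))} {x} {y} (s≤s (s≤s z≤n)) x<g y<g with y + x * g in y+x*g≡
... | zero = sym (cong₂ _+_ (m+n≡0⇒m≡0 y y+x*g≡) (m*n≡0⇒m≡0 x g (m+n≡0⇒n≡0 y y+x*g≡)))
... | suc M
  rewrite m*n%n≡0 (suc M) g {{_}} | m*n/n≡m (suc M) g {{_}}
        | trans (cong (_% g) (sym y+x*g≡)) ([y+x*g]%g≡y x y<g)
        | trans (cong (_/ g) (sym y+x*g≡)) ([y+x*g]/g≡x x y<g)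
  with x | k + M * g in fuel
... | zero   | zero  = refl
... | zero   | suc _ = refl
... | suc x' | zero  = contradiction (trans y+x*g≡ (cong suc M≡0)) (>⇒≢ 1<y+x*g)
  where
  M≡0 : M ≡ 0
  M≡0 = m*n≡0⇒m≡0 M g (m+n≡0⇒n≡0 k fuel)
  1<y+x*g : 1 < y + suc x' * g
  1<y+x*g = ≤-trans (s≤s (s≤s z≤n)) (m≤n+m _ y)
... | suc x' | suc f
  rewrite m<n⇒m%n≡m x<g | m<n⇒m/n≡0 x<g with f
... | zero  = cong (λ t → y + suc t) (+-identityʳ x')
... | suc _ = cong (λ t → y + suc t) (+-identityʳ x')

s[k*g]≡k : ∀ {g k} → 1 < g → k < g → s g (k * g) ≡ k
s[k*g]≡k {g} {k} 1<g k<g =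
  subst (λ t → s g (t * g) ≡ t) (+-identityʳ k) (s[[y+x*g]*g]≡y+x 1<g (<-trans (s≤s z≤n) 1<g) k<g)

s[k*g]≢g : ∀ {m g k} → 1 < g → m ≡ k * g → k < g → s g m ≢ g
s[k*g]≢g 1<g refl k<g s≡g = <⇒≢ k<g (trans (sym (s[k*g]≡k 1<g k<g)) s≡g)

d∣t<2d⇒t≡0∨t≡d : ∀ {d t} → d ∣ t → t < d + d → t ≡ 0 ⊎ t ≡ d
d∣t<2d⇒t≡0∨t≡d (divides zero          refl) _     = inj₁ refl
d∣t<2d⇒t≡0∨t≡d (divides (suc zero)    refl) _     = inj₂ (+-identityʳ _)
d∣t<2d⇒t≡0∨t≡d {d} (divides (suc (suc q)) refl) t<2d =
  contradiction (+-monoʳ-≤ d (m≤m+n d (q * d))) (<⇒≱ t<2d)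

y+x*c≤[y+x]*c : ∀ {c} .{{_ : NonZero c}} y x → y + x * c ≤ (y + x) * c
y+x*c≤[y+x]*c {c} y x = ≤-trans (+-monoˡ-≤ (x * c) (m≤m*n y c)) (≤-reflexive (sym (*-distribʳ-+ c y x)))

s[n*c]≡c : ∀ {c n} → 1 < c → c < n → n < c * c → (c ∸ 1) ∣ (n ∸ 1) → s c (n * c) ≡ c
s[n*c]≡c {c@(suc d)} {n} 1<c c<n n<c² d∣n∸1 = begin
  s c (n * c)            ≡⟨ cong (λ t → s c (t * c)) n≡y+x*c ⟩
  s c ((y + x * c) * c)  ≡⟨ s[[y+x*g]*g]≡y+x 1<c x<c y<c ⟩
  y + x                  ≡⟨ y+x≡c ⟩
  c                      ∎
  where
  open ≡-Reasoning
  x = n / c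
  y = n % c
  n≡y+x*c : n ≡ y + x * c
  n≡y+x*c = m≡m%n+[m/n]*n n c
  x<c : x < c
  x<c = m<n*o⇒m/o<n n<c²
  y<c : y < c
  y<c = m%n<n n c
  1<y+x : 1 < y + x
  1<y+x = ≰⇒> (λ y+x≤1 → <⇒≱ c<n (≤-trans (≤-reflexive n≡y+x*c)
    (≤-trans (y+x*c≤[y+x]*c y x) (≤-trans (*-monoˡ-≤ c y+x≤1) (≤-reflexive (*-identityˡ c))))))
  t = y + x ∸ 1
  n∸1≡x*d+t : n ∸ 1 ≡ x * d + t
  n∸1≡x*d+t = begin
    n ∸ 1                ≡⟨ cong (_∸ 1) (trans n≡y+x*c (cong (y +_) (*-suc x d))) ⟩
    y + (x + x * d) ∸ 1  ≡⟨ cong (_∸ 1) (+-assoc y x (x * d)) ⟨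
    y + x + x * d ∸ 1    ≡⟨ +-∸-comm (x * d) (<⇒≤ 1<y+x) ⟩
    t + x * d            ≡⟨ +-comm t (x * d) ⟩
    x * d + t            ∎
  t<d+d : t < d + d
  t<d+d = ∸-monoˡ-< (s≤s (+-mono-≤ (s≤s⁻¹ y<c) (s≤s⁻¹ x<c))) (<⇒≤ 1<y+x)
  y+x≡c : y + x ≡ c
  y+x≡c with d∣t<2d⇒t≡0∨t≡d (∣m+n∣m⇒∣n (subst (d ∣_) n∸1≡x*d+t d∣n∸1) (n∣m*n x)) t<d+d
  ... | inj₁ t≡0 = contradiction (m∸n≡0⇒m≤n t≡0) (<⇒≱ 1<y+x)
  ... | inj₂ t≡d = trans (sym (m+[n∸m]≡n (<⇒≤ 1<y+x))) (cong suc t≡d)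

[d∸1]∣[n*d∸1]⇒[d∸1]∣[n∸1] : ∀ {d n} → 0 < d → 0 < n → (d ∸ 1) ∣ (n * d ∸ 1) → (d ∸ 1) ∣ (n ∸ 1)
[d∸1]∣[n*d∸1]⇒[d∸1]∣[n∸1] {suc d} {n} _ 0<n d∣n*[1+d]∸1 = ∣m+n∣m⇒∣n (subst (d ∣_) n*[1+d]∸1≡ d∣n*[1+d]∸1) (n∣m*n n)
  where
  n*[1+d]∸1≡ : n * suc d ∸ 1 ≡ n * d + (n ∸ 1)
  n*[1+d]∸1≡ = trans (cong (_∸ 1) (trans (*-suc n d) (+-comm n (n * d)))) (+-∸-assoc (n * d) 0<n)

[c∸1]∣[n∸1]⇒c≤n : ∀ {c n} → 1 < n → (c ∸ 1) ∣ (n ∸ 1) → c ≤ n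
[c∸1]∣[n∸1]⇒c≤n {c} {n} 1<n c∸1∣n∸1 = begin
  c              ≤⟨ m≤n+m∸n c 1 ⟩
  1 + (c ∸ 1)    ≤⟨ s≤s (∣⇒≤ {{>-nonZero (m<n⇒0<n∸m 1<n)}} c∸1∣n∸1) ⟩
  1 + (n ∸ 1)    ≡⟨ m+[n∸m]≡n (<⇒≤ 1<n) ⟩
  n              ∎
  where open ≤-Reasoning

carmichael⇒s[abc]≡c : ∀ {m a b c} → InC m → Prime a → Prime b → Prime c → a < b → b < c →
                      m ≡ a * b * c → c < a * b × s c m ≡ c
carmichael⇒s[abc]≡c {m} {a} {b} {c} carmichael pa pb pc a<b b<c m≡abc =
  c<ab , subst (λ t → s c t ≡ c) (sym m≡abc) (s[n*c]≡c (prime⇒>1 pc) c<ab (*-mono-< a<c b<c) c∸1∣ab∸1)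
  where
  a<c = <-trans a<b b<c
  1<ab : 1 < a * b
  1<ab = <-≤-trans (prime⇒>1 pb) (m≤n*m b a {{prime⇒nonZero pa}})
  c∸1∣ab∸1 : (c ∸ 1) ∣ (a * b ∸ 1)
  c∸1∣ab∸1 = [d∸1]∣[n*d∸1]⇒[d∸1]∣[n∸1] (<-trans (s≤s z≤n) (prime⇒>1 pc)) (<-trans (s≤s z≤n) 1<ab)
    (subst (λ t → (c ∸ 1) ∣ (t ∸ 1)) m≡abc (carmichael⇒korselt carmichael pc (divides (a * b) m≡abc)))
  c≢ab : c ≢ a * b
  c≢ab c≡ab = <⇒≢ a<c (prime∣prime⇒≡ pa pc (divides b (trans c≡ab (*-comm a b))))
  c<ab : c < a * b
  c<ab = ≤∧≢⇒< ([c∸1]∣[n∸1]⇒c≤n 1<ab c∸1∣ab∸1) c≢ab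

-- Strict s-decompositions

strictSDecomp⇒base : ∀ {m ds p} → StrictSDecomp m ds → Prime p → p ∣ m →
                     ∃[ g ] (p ∣ g × g ∣ m × 1 < g × g < m × s g m ≡ g)
strictSDecomp⇒base {m} {ds} {p} (_ , _ , bases , m≡Π) pp p∣m with prime∣product⇒∈ pp _ (subst (p ∣_) m≡Π p∣m)
... | x , x∈Π , p∣x with ∈-map⁻ {A = ℕ × ℕ} _ {xs = ds} x∈Π
...   | (g , e) , ge∈ds , refl with lookup bases ge∈ds
...     | 0<e , 1<g , g<m , s[m]≡g =
  g , prime∣^⇒∣ pp e p∣x , subst (g ∣_) (sym m≡Π) (∣-trans (∣-^ 0<e) (∈⇒∣product x∈Π)) , 1<g , g<m , s[m]≡g

cofactor<base : ∀ {p o c g k h} → Prime p → Prime o → Prime c → o < c → c < p * o →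
                g ≢ p → k ≢ 1 → g ≡ h * p → o * c ≡ k * h → k < g
cofactor<base {p} {o} {c} {g} {k} {h} pp po pc o<c c<po g≢p k≢1 g≡h*p oc≡kh
  with ∣p*q⇒ po pc (divides h (trans oc≡kh (*-comm k h)))
... | inj₁ k≡1 = contradiction k≡1 k≢1
... | inj₂ (inj₁ refl) = begin-strict
  o      <⟨ o<c ⟩
  c      ≤⟨ m≤m*n c p {{prime⇒nonZero pp}} ⟩
  c * p  ≡⟨ cong (_* p) (*-cancelˡ-≡ c h o {{prime⇒nonZero po}} oc≡kh) ⟩
  h * p  ≡⟨ g≡h*p ⟨
  g      ∎
  where open ≤-Reasoning
... | inj₂ (inj₂ (inj₁ refl)) = begin-strict
  c      <⟨ c<po ⟩
  p * o  ≡⟨ *-comm p o ⟩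
  o * p  ≡⟨ cong (_* p) (*-cancelˡ-≡ o h c {{prime⇒nonZero pc}} (trans (*-comm c o) oc≡kh)) ⟩
  h * p  ≡⟨ g≡h*p ⟨
  g      ∎
  where open ≤-Reasoning
... | inj₂ (inj₂ (inj₂ refl)) = contradiction (trans g≡h*p (trans (cong (_* p) h≡1) (*-identityˡ p))) g≢p
  where
  h≡1 : h ≡ 1
  h≡1 = sym (*-cancelˡ-≡ 1 h (o * c) {{m*n≢0 o c {{prime⇒nonZero po}} {{prime⇒nonZero pc}}}}
    (trans (*-identityʳ (o * c)) oc≡kh))

noStrictSDecomp : ∀ {m p o c} → Prime p → Prime o → Prime c → o < c → c < p * o →
                  m ≡ p * o * c → s p m ≢ p → ¬ InS m
noStrictSDecomp {m} {p} {o} {c} pp po pc o<c c<po m≡poc s[m]≢p (_ , _ , decomp)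
  with strictSDecomp⇒base decomp pp (divides (o * c) (trans m≡poc (rotate p o c)))
  where
  rotate : ∀ p o c → p * o * c ≡ o * c * p
  rotate = solve-∀
... | g , divides h g≡h*p , divides k m≡k*g , 1<g , g<m , s[m]≡g with g ≟ p | k ≟ 1
...   | yes refl | _        = contradiction s[m]≡g s[m]≢p
...   | no _     | yes refl = contradiction (subst (g <_) (trans m≡k*g (*-identityˡ g)) g<m) (<-irrefl refl)
...   | no g≢p   | no k≢1   = s[k*g]≢g 1<g m≡k*g (cofactor<base pp po pc o<c c<po g≢p k≢1 g≡h*p oc≡kh) s[m]≡g
  where
  oc≡kh : o * c ≡ k * h
  oc≡kh = *-cancelˡ-≡ (o * c) (k * h) p {{prime⇒nonZero pp}} (begin
    p * (o * c)   ≡⟨ *-assoc p o c ⟨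
    p * o * c     ≡⟨ m≡poc ⟨
    m             ≡⟨ m≡k*g ⟩
    k * g         ≡⟨ cong (k *_) g≡h*p ⟩
    k * (h * p)   ≡⟨ shuffle k h p ⟩
    p * (k * h)   ∎)
    where
    open ≡-Reasoning
    shuffle : ∀ k h p → k * (h * p) ≡ p * (k * h)
    shuffle = solve-∀

C₃∖C′₃⊆L∖S : ∀ m → InC3 m → ¬ InC'3 m → InL m × ¬ InS m
C₃∖C′₃⊆L∖S m (carmichael@(m-composite , _) , ω≡3) m∉C′₃ =
  (>-nonZero⁻¹ m , c , divides (a * b) m≡abc , proj₂ c<ab×s[m]≡c) , m∉S
  where
  instance
    m≢0 : NonZero m
    m≢0 = composite⇒nonZero m-composite
  squarefree = carmichael⇒squareFree carmichael
  open PrimeTriple (squareFree∧ω≡3⇒primeTriple squarefree ω≡3)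
  c<ab×s[m]≡c = carmichael⇒s[abc]≡c carmichael prime-a prime-b prime-c a<b b<c m≡abc
  m∉S : ¬ InS m
  m∉S with s a m ≟ a | s b m ≟ b
  ... | no s[m]≢a | _ = noStrictSDecomp prime-a prime-b prime-c b<c (proj₁ c<ab×s[m]≡c) m≡abc s[m]≢a
  ... | yes _ | no s[m]≢b = noStrictSDecomp prime-b prime-a prime-c (<-trans a<b b<c)
    (subst (c <_) (*-comm a b) (proj₁ c<ab×s[m]≡c)) (trans m≡abc (cong (_* c) (*-comm a b))) s[m]≢b
  ... | yes s[m]≡a | yes s[m]≡b =
    contradiction ((squarefree , nonTrivial⇒n>1 m {{composite⇒nonTrivial m-composite}} , s[m]≡p) , ω≡3) m∉C′₃
    where
    s[m]≡p : ∀ p → Prime p → p ∣ m → s p m ≡ p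
    s[m]≡p p pp p∣m with primeFactor∈abc pp p∣m
    ... | inj₁ refl        = s[m]≡a
    ... | inj₂ (inj₁ refl) = s[m]≡b
    ... | inj₂ (inj₂ refl) = proj₂ c<ab×s[m]≡c

-- The witnesses 172081 and 6

primeFactors-172081 : List ℕ
primeFactors-172081 = 7 ∷ 13 ∷ 31 ∷ 61 ∷ []

carmichael-172081 : InC 172081
carmichael-172081 =
  hasNonTrivialDivisor {divisor = 7} (<ᵇ⇒< _ _ tt) (divides 24583 refl) ,
  korselt⇒carmichael (toWitness {a? = allPairs? _<?_ primeFactors-172081} tt)
                     (toWitness {a? = all? prime? primeFactors-172081} tt)
                     (toWitness {a? = all? (λ p → (p ∸ 1) ∣? (172081 ∸ 1)) primeFactors-172081} tt)

strictSDecomp-172081 : StrictSDecomp 172081 ((31 , 1) ∷ (61 , 1) ∷ (91 , 1) ∷ [])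
strictSDecomp-172081 =
  (λ ()) , <ᵇ⇒< _ _ tt ∷ <ᵇ⇒< _ _ tt ∷ [-] ,
  (s≤s z≤n , <ᵇ⇒< _ _ tt , <ᵇ⇒< _ _ tt , refl) ∷ (s≤s z≤n , <ᵇ⇒< _ _ tt , <ᵇ⇒< _ _ tt , refl) ∷
  (s≤s z≤n , <ᵇ⇒< _ _ tt , <ᵇ⇒< _ _ tt , refl) ∷ [] ,
  refl

172081∉C′ : ¬ InC' 172081
172081∉C′ (_ , _ , s[m]≡p) with s[m]≡p 7 (toWitness {a? = prime? 7} tt) (divides 24583 refl)
... | ()

6∉S : ¬ InS 6
6∉S (_ , _ , decomp) with strictSDecomp⇒base decomp (toWitness {a? = prime? 3} tt) (divides 2 refl)
... | _ , divides zero refl          , _ , () , _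
... | _ , divides (suc zero) refl    , _ , _  , _   , ()
... | _ , divides (suc (suc h)) refl , _ , _  , g<6 , _ = contradiction (m≤m+n 6 (h * 3)) (<⇒≱ g<6)

6∉C : ¬ InC 6
6∉C (_ , carmichael) with carmichael 5 (toWitness {a? = coprime? 5 6} tt)
... | ()

theorem2p4 : (∃[ m ] (InC m × ¬ InC' m × ¬ (InL m × ¬ InS m)))
    × ((∀ m → InC3 m → ¬ InC'3 m → InL m × ¬ InS m)
       × ∃[ m ] ((InL m × ¬ InS m) × ¬ (InC3 m × ¬ InC'3 m)))
theorem2p4 =
  (172081 , carmichael-172081 , 172081∉C′ , λ (_ , m∉S) → m∉S (s≤s z≤n , _ , strictSDecomp-172081)) ,
  C₃∖C′₃⊆L∖S ,
  (6 , ((s≤s z≤n , 2 , divides 3 refl , refl) , 6∉S) , λ ((6∈C , _) , _) → 6∉C 6∈C)
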